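{- For every computation $M$ of $\lambda_{\copyright}$, the following are equivalent: (1) $M \to_{\copyright}^* !V$ for some value $V$; (2) $M (\to^{\mathsf w}_{\beta_c})^* !U$ for some value $U$.
   Context: The computational core $\lambda_{\copyright}$ has values $V,W ::= x \mid \lambda x.M$ and computations $M,N,L ::= \,!V \mid VM$ ($x$ ranging over a countable set of variables, terms up to $\alpha$-renaming). Rules: $\beta_c$: $(\lambda x.M)(!V) \mapsto M\{V/x\}$; $\mathsf{id}$: $(\lambda x.!x)M \mapsto M$; $\sigma$: $(\lambda y.N)((\lambda x.M)L) \mapsto (\lambda x.(\lambda y.N)M)L$ provided $x\notin \mathrm{fv}(N)$; $\copyright=\beta_c\cup\mathsf{id}\cup\sigma$. Contexts: $C ::= [\,] \mid\, !(\lambda x.C) \mid VC \mid (\lambda x.C)M$; weak contexts $W ::= [\,]\mid VW$. $\to_\rho$ is closure of rule $\rho$ under all contexts, $\to^{\mathsf w}_\rho$ its closure under weak contexts; $^*$ is reflexive–transitive closure. -}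

module Defs where

open import Data.Nat using (ℕ; zero; suc)
open import Data.Fin using (Fin; zero; suc)
open import Relation.Binary.Construct.Closure.ReflexiveTransitive using (Star)
open import Data.Product using (∃)

-- Terms of the computational core, well-scoped de Bruijn syntax
-- (terms up to α-renaming).  n = number of free variables in scope.
mutual
  data Val (n : ℕ) : Set where
    var : Fin n → Val n
    lam : Comp (suc n) → Val n

  data Comp (n : ℕ) : Set where
    ret : Val n → Comp n              -- !V
    app : Val n → Comp n → Comp n

Ren : ℕ → ℕ → Set
Ren m n = Fin m → Fin n

liftRen : ∀ {m n} → Ren m n → Ren (suc m) (suc n)
liftRen ρ zero    = zero
liftRen ρ (suc i) = suc (ρ i)

mutual
  renV : ∀ {m n} → Ren m n → Val m → Val n
  renV ρ (var i) = var (ρ i)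
  renV ρ (lam M) = lam (renC (liftRen ρ) M)

  renC : ∀ {m n} → Ren m n → Comp m → Comp n
  renC ρ (ret V)   = ret (renV ρ V)
  renC ρ (app V M) = app (renV ρ V) (renC ρ M)

Sub : ℕ → ℕ → Set
Sub m n = Fin m → Val n

liftSub : ∀ {m n} → Sub m n → Sub (suc m) (suc n)
liftSub σ zero    = var zero
liftSub σ (suc i) = renV suc (σ i)

mutual
  subV : ∀ {m n} → Sub m n → Val m → Val n
  subV σ (var i) = σ i
  subV σ (lam M) = lam (subC (liftSub σ) M)

  subC : ∀ {m n} → Sub m n → Comp m → Comp n
  subC σ (ret V)   = ret (subV σ V)
  subC σ (app V M) = app (subV σ V) (subC σ M)

single : ∀ {n} → Val n → Sub (suc n) n
single V zero    = V
single V (suc i) = var i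

_[_] : ∀ {n} → Comp (suc n) → Val n → Comp n
M [ V ] = subC (single V) M

-- weakening of a term under one binder, skipping index 0:
-- used for N in rule σ (N lives under y; in the result it is under x then y,
-- and x ∉ fv(N) holds by construction)
weakUnder : ∀ {n} → Comp (suc n) → Comp (suc (suc n))
weakUnder = renC (liftRen suc)

Rel : Set₁
Rel = ∀ {n} → Comp n → Comp n → Set

data βc : Rel where
  βc-rule : ∀ {n} (M : Comp (suc n)) (V : Val n) →
            βc (app (lam M) (ret V)) (M [ V ])

data idR : Rel where
  id-rule : ∀ {n} (M : Comp n) →
            idR (app (lam (ret (var zero))) M) M

-- σ : (λy.N)((λx.M)L) ↦ (λx.(λy.N)M)L
data σR : Rel where
  σ-rule : ∀ {n} (N : Comp (suc n)) (M : Comp (suc n)) (L : Comp n) →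
           σR (app (lam N) (app (lam M) L))
              (app (lam (app (lam (weakUnder N)) M)) L)

data ©R : Rel where
  by-βc : ∀ {n} {M N : Comp n} → βc M N → ©R M N
  by-id : ∀ {n} {M N : Comp n} → idR M N → ©R M N
  by-σ  : ∀ {n} {M N : Comp n} → σR M N → ©R M N

data Ctx (ρ : Rel) : Rel where
  root   : ∀ {n} {M N : Comp n} → ρ M N → Ctx ρ M N
  retLam : ∀ {n} {M N : Comp (suc n)} → Ctx ρ M N → Ctx ρ (ret (lam M)) (ret (lam N))
  appR   : ∀ {n} (V : Val n) {M N : Comp n} → Ctx ρ M N → Ctx ρ (app V M) (app V N)
  appLam : ∀ {n} {M N : Comp (suc n)} (L : Comp n) → Ctx ρ M N → Ctx ρ (app (lam M) L) (app (lam N) L)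

data WCtx (ρ : Rel) : Rel where
  root : ∀ {n} {M N : Comp n} → ρ M N → WCtx ρ M N
  appR : ∀ {n} (V : Val n) {M N : Comp n} → WCtx ρ M N → WCtx ρ (app V M) (app V N)

_→©*_ : ∀ {n} → Comp n → Comp n → Set
_→©*_ = Star (Ctx ©R)

_→wβc*_ : ∀ {n} → Comp n → Comp n → Set
_→wβc*_ = Star (WCtx βc)

-- Weak βc-evaluation to a value is a big-step relation M ⇓ U.  Every
-- ©-step is a parallel reduction M ⇒ N (βc, id and σ redexes contracted
-- simultaneously, anywhere), and ⇓ is reflected by ⇒: if M ⇒ N and N ⇓ U,
-- then M ⇓ U₀ for some U₀ ⇒ U.  Hence a ©-reduction M →©* !V, read
-- backwards from !V ⇓ V, yields an evaluation M ⇓ U₀, i.e. a weak βc-reduction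
-- M to !U₀.  The converse holds since weak βc-steps are ©-steps.
module Submission where

open import Defs
open import Data.Nat using (ℕ; zero; suc)
open import Data.Fin using (zero; suc)
open import Data.Product using (∃; _,_; _×_; proj₂)
open import Function using (_∘_)
open import Function.Bundles using (_⇔_; mk⇔)
open import Relation.Binary.PropositionalEquality using (_≡_; refl; sym; trans; cong; cong₂; subst)
open import Relation.Binary.Construct.Closure.ReflexiveTransitive using (ε; _◅_; _◅◅_; gmap; map)

liftRen-cong : ∀ {m n} {ρ ρ' : Ren m n} → (∀ i → ρ i ≡ ρ' i) → ∀ i → liftRen ρ i ≡ liftRen ρ' i
liftRen-cong e zero    = refl
liftRen-cong e (suc i) = cong suc (e i)

mutual
  renV-cong : ∀ {m n} {ρ ρ' : Ren m n} → (∀ i → ρ i ≡ ρ' i) → ∀ V → renV ρ V ≡ renV ρ' V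
  renV-cong e (var i) = cong var (e i)
  renV-cong e (lam M) = cong lam (renC-cong (liftRen-cong e) M)

  renC-cong : ∀ {m n} {ρ ρ' : Ren m n} → (∀ i → ρ i ≡ ρ' i) → ∀ M → renC ρ M ≡ renC ρ' M
  renC-cong e (ret V)   = cong ret (renV-cong e V)
  renC-cong e (app V M) = cong₂ app (renV-cong e V) (renC-cong e M)

mutual
  renV-renV : ∀ {l m n} (ρ : Ren m n) (ρ' : Ren l m) V → renV ρ (renV ρ' V) ≡ renV (ρ ∘ ρ') V
  renV-renV ρ ρ' (var i) = refl
  renV-renV ρ ρ' (lam M) = cong lam (trans (renC-renC (liftRen ρ) (liftRen ρ') M)
                                           (renC-cong (λ { zero → refl ; (suc i) → refl }) M))

  renC-renC : ∀ {l m n} (ρ : Ren m n) (ρ' : Ren l m) M → renC ρ (renC ρ' M) ≡ renC (ρ ∘ ρ') M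
  renC-renC ρ ρ' (ret V)   = cong ret (renV-renV ρ ρ' V)
  renC-renC ρ ρ' (app V M) = cong₂ app (renV-renV ρ ρ' V) (renC-renC ρ ρ' M)

liftSub-cong : ∀ {m n} {σ σ' : Sub m n} → (∀ i → σ i ≡ σ' i) → ∀ i → liftSub σ i ≡ liftSub σ' i
liftSub-cong e zero    = refl
liftSub-cong e (suc i) = cong (renV suc) (e i)

mutual
  subV-cong : ∀ {m n} {σ σ' : Sub m n} → (∀ i → σ i ≡ σ' i) → ∀ V → subV σ V ≡ subV σ' V
  subV-cong e (var i) = e i
  subV-cong e (lam M) = cong lam (subC-cong (liftSub-cong e) M)

  subC-cong : ∀ {m n} {σ σ' : Sub m n} → (∀ i → σ i ≡ σ' i) → ∀ M → subC σ M ≡ subC σ' M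
  subC-cong e (ret V)   = cong ret (subV-cong e V)
  subC-cong e (app V M) = cong₂ app (subV-cong e V) (subC-cong e M)

mutual
  subV-renV : ∀ {l m n} (σ : Sub m n) (ρ : Ren l m) V → subV σ (renV ρ V) ≡ subV (σ ∘ ρ) V
  subV-renV σ ρ (var i) = refl
  subV-renV σ ρ (lam M) = cong lam (trans (subC-renC (liftSub σ) (liftRen ρ) M)
                                          (subC-cong (λ { zero → refl ; (suc i) → refl }) M))

  subC-renC : ∀ {l m n} (σ : Sub m n) (ρ : Ren l m) M → subC σ (renC ρ M) ≡ subC (σ ∘ ρ) M
  subC-renC σ ρ (ret V)   = cong ret (subV-renV σ ρ V)
  subC-renC σ ρ (app V M) = cong₂ app (subV-renV σ ρ V) (subC-renC σ ρ M)

mutual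
  renV-subV : ∀ {l m n} (ρ : Ren m n) (σ : Sub l m) V → renV ρ (subV σ V) ≡ subV (renV ρ ∘ σ) V
  renV-subV ρ σ (var i) = refl
  renV-subV ρ σ (lam M) = cong lam (trans (renC-subC (liftRen ρ) (liftSub σ) M) (subC-cong lift-comm M))
    where
    lift-comm : ∀ i → renV (liftRen ρ) (liftSub σ i) ≡ liftSub (renV ρ ∘ σ) i
    lift-comm zero    = refl
    lift-comm (suc i) = trans (renV-renV (liftRen ρ) suc (σ i)) (sym (renV-renV suc ρ (σ i)))

  renC-subC : ∀ {l m n} (ρ : Ren m n) (σ : Sub l m) M → renC ρ (subC σ M) ≡ subC (renV ρ ∘ σ) M
  renC-subC ρ σ (ret V)   = cong ret (renV-subV ρ σ V)
  renC-subC ρ σ (app V M) = cong₂ app (renV-subV ρ σ V) (renC-subC ρ σ M)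

mutual
  subV-var : ∀ {n} (V : Val n) → subV var V ≡ V
  subV-var (var i) = refl
  subV-var (lam M) = cong lam (trans (subC-cong (λ { zero → refl ; (suc i) → refl }) M) (subC-var M))

  subC-var : ∀ {n} (M : Comp n) → subC var M ≡ M
  subC-var (ret V)   = cong ret (subV-var V)
  subC-var (app V M) = cong₂ app (subV-var V) (subC-var M)

mutual
  subV-subV : ∀ {l m n} (σ : Sub m n) (τ : Sub l m) V → subV σ (subV τ V) ≡ subV (subV σ ∘ τ) V
  subV-subV σ τ (var i) = refl
  subV-subV σ τ (lam M) = cong lam (trans (subC-subC (liftSub σ) (liftSub τ) M) (subC-cong lift-comm M))
    where
    lift-comm : ∀ i → subV (liftSub σ) (liftSub τ i) ≡ liftSub (subV σ ∘ τ) i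
    lift-comm zero    = refl
    lift-comm (suc i) = trans (subV-renV (liftSub σ) suc (τ i)) (sym (renV-subV suc σ (τ i)))

  subC-subC : ∀ {l m n} (σ : Sub m n) (τ : Sub l m) M → subC σ (subC τ M) ≡ subC (subV σ ∘ τ) M
  subC-subC σ τ (ret V)   = cong ret (subV-subV σ τ V)
  subC-subC σ τ (app V M) = cong₂ app (subV-subV σ τ V) (subC-subC σ τ M)

renC-[] : ∀ {m n} (ρ : Ren m n) (P : Comp (suc m)) V →
          renC ρ (P [ V ]) ≡ renC (liftRen ρ) P [ renV ρ V ]
renC-[] ρ P V = trans (renC-subC ρ (single V) P)
  (trans (subC-cong (λ { zero → refl ; (suc i) → refl }) P)
         (sym (subC-renC (single (renV ρ V)) (liftRen ρ) P)))

subC-[] : ∀ {m n} (σ : Sub m n) (P : Comp (suc m)) V →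
          subC σ (P [ V ]) ≡ subC (liftSub σ) P [ subV σ V ]
subC-[] σ P V = trans (subC-subC σ (single V) P)
  (trans (subC-cong single-comm P) (sym (subC-subC (single (subV σ V)) (liftSub σ) P)))
  where
  single-comm : ∀ i → subV σ (single V i) ≡ subV (single (subV σ V)) (liftSub σ i)
  single-comm zero    = refl
  single-comm (suc i) = sym (trans (subV-renV (single (subV σ V)) suc (σ i)) (subV-var (σ i)))

renC-weakUnder : ∀ {m n} (ρ : Ren m n) (Q : Comp (suc m)) →
                 renC (liftRen (liftRen ρ)) (weakUnder Q) ≡ weakUnder (renC (liftRen ρ) Q)
renC-weakUnder ρ Q = trans (renC-renC (liftRen (liftRen ρ)) (liftRen suc) Q)
  (trans (renC-cong (λ { zero → refl ; (suc i) → refl }) Q)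
         (sym (renC-renC (liftRen suc) (liftRen ρ) Q)))

subC-weakUnder : ∀ {m n} (σ : Sub m n) (Q : Comp (suc m)) →
                 subC (liftSub (liftSub σ)) (weakUnder Q) ≡ weakUnder (subC (liftSub σ) Q)
subC-weakUnder σ Q = trans (subC-renC (liftSub (liftSub σ)) (liftRen suc) Q)
  (trans (subC-cong lift-comm Q) (sym (renC-subC (liftRen suc) (liftSub σ) Q)))
  where
  lift-comm : ∀ i → liftSub (liftSub σ) (liftRen suc i) ≡ renV (liftRen suc) (liftSub σ i)
  lift-comm zero    = refl
  lift-comm (suc i) = trans (renV-renV suc suc (σ i)) (sym (renV-renV (liftRen suc) suc (σ i)))

weakUnder-[]-cancel : ∀ {n} (Q : Comp (suc n)) (W : Val n) →
                      subC (liftSub (single W)) (weakUnder Q) ≡ Q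
weakUnder-[]-cancel Q W = trans (subC-renC (liftSub (single W)) (liftRen suc) Q)
  (trans (subC-cong (λ { zero → refl ; (suc i) → refl }) Q) (subC-var Q))

-- The index counts the βc- and id-redexes contracted at the head of the
-- term; it is what makes ⇓-reflect below terminate.
infix 4 _⇒v_ _⇒⟨_⟩_ _⇒s_ _⇓_

mutual
  data _⇒v_ {n} : Val n → Val n → Set where
    pvar : ∀ {i} → var i ⇒v var i
    plam : ∀ {k P P'} → P ⇒⟨ k ⟩ P' → lam P ⇒v lam P'

  data _⇒⟨_⟩_ {n} : Comp n → ℕ → Comp n → Set where
    pret  : ∀ {V V'} → V ⇒v V' → ret V ⇒⟨ 0 ⟩ ret V'
    papp  : ∀ {k V V' M M'} → V ⇒v V' → M ⇒⟨ k ⟩ M' → app V M ⇒⟨ k ⟩ app V' M'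
    pbeta : ∀ {k P P' V V'} → P ⇒⟨ k ⟩ P' → V ⇒v V' →
            app (lam P) (ret V) ⇒⟨ suc k ⟩ P' [ V' ]
    pid   : ∀ {k M M'} → M ⇒⟨ k ⟩ M' → app (lam (ret (var zero))) M ⇒⟨ suc k ⟩ M'
    psig  : ∀ {a b k Q Q' P P' L L'} → Q ⇒⟨ a ⟩ Q' → P ⇒⟨ b ⟩ P' → L ⇒⟨ k ⟩ L' →
            app (lam Q) (app (lam P) L) ⇒⟨ 0 ⟩ app (lam (app (lam (weakUnder Q')) P')) L'

mutual
  ⇒v-refl : ∀ {n} (V : Val n) → V ⇒v V
  ⇒v-refl (var i) = pvar
  ⇒v-refl (lam M) = plam (proj₂ (⇒-refl M))

  ⇒-refl : ∀ {n} (M : Comp n) → ∃ λ k → M ⇒⟨ k ⟩ M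
  ⇒-refl (ret V)   = 0 , pret (⇒v-refl V)
  ⇒-refl (app V M) = let k , r = ⇒-refl M in k , papp (⇒v-refl V) r

mutual
  ⇒v-renV : ∀ {m n} (ρ : Ren m n) {V V'} → V ⇒v V' → renV ρ V ⇒v renV ρ V'
  ⇒v-renV ρ pvar     = pvar
  ⇒v-renV ρ (plam r) = plam (⇒-renC (liftRen ρ) r)

  ⇒-renC : ∀ {m n k} (ρ : Ren m n) {M M'} → M ⇒⟨ k ⟩ M' → renC ρ M ⇒⟨ k ⟩ renC ρ M'
  ⇒-renC ρ (pret v)   = pret (⇒v-renV ρ v)
  ⇒-renC ρ (papp v r) = papp (⇒v-renV ρ v) (⇒-renC ρ r)
  ⇒-renC ρ (pbeta {P' = P'} {V' = V'} r v) =
    subst (_ ⇒⟨ _ ⟩_) (sym (renC-[] ρ P' V')) (pbeta (⇒-renC (liftRen ρ) r) (⇒v-renV ρ v))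
  ⇒-renC ρ (pid r)    = pid (⇒-renC ρ r)
  ⇒-renC ρ (psig {Q' = Q'} q p l) =
    subst (λ X → _ ⇒⟨ _ ⟩ app (lam (app (lam X) _)) _) (sym (renC-weakUnder ρ Q'))
      (psig (⇒-renC (liftRen ρ) q) (⇒-renC (liftRen ρ) p) (⇒-renC ρ l))

_⇒s_ : ∀ {m n} → Sub m n → Sub m n → Set
σ ⇒s σ' = ∀ i → σ i ⇒v σ' i

⇒s-liftSub : ∀ {m n} {σ σ' : Sub m n} → σ ⇒s σ' → liftSub σ ⇒s liftSub σ'
⇒s-liftSub s zero    = pvar
⇒s-liftSub s (suc i) = ⇒v-renV suc (s i)

⇒s-single : ∀ {n} {W W' : Val n} → W ⇒v W' → single W ⇒s single W'
⇒s-single w zero    = w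
⇒s-single w (suc i) = pvar

mutual
  ⇒v-subV : ∀ {m n} {σ σ' : Sub m n} → σ ⇒s σ' → ∀ {V V'} → V ⇒v V' → subV σ V ⇒v subV σ' V'
  ⇒v-subV s (pvar {i}) = s i
  ⇒v-subV s (plam r)   = plam (⇒-subC (⇒s-liftSub s) r)

  ⇒-subC : ∀ {m n k} {σ σ' : Sub m n} → σ ⇒s σ' → ∀ {M M'} → M ⇒⟨ k ⟩ M' →
           subC σ M ⇒⟨ k ⟩ subC σ' M'
  ⇒-subC s (pret v)   = pret (⇒v-subV s v)
  ⇒-subC s (papp v r) = papp (⇒v-subV s v) (⇒-subC s r)
  ⇒-subC {σ' = σ'} s (pbeta {P' = P'} {V' = V'} r v) =
    subst (_ ⇒⟨ _ ⟩_) (sym (subC-[] σ' P' V')) (pbeta (⇒-subC (⇒s-liftSub s) r) (⇒v-subV s v))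
  ⇒-subC s (pid r)    = pid (⇒-subC s r)
  ⇒-subC {σ' = σ'} s (psig {Q' = Q'} q p l) =
    subst (λ X → _ ⇒⟨ _ ⟩ app (lam (app (lam X) _)) _) (sym (subC-weakUnder σ' Q'))
      (psig (⇒-subC (⇒s-liftSub s) q) (⇒-subC (⇒s-liftSub s) p) (⇒-subC s l))

⇒-[] : ∀ {n k} {P P' : Comp (suc n)} {W W'} → P ⇒⟨ k ⟩ P' → W ⇒v W' → P [ W ] ⇒⟨ k ⟩ P' [ W' ]
⇒-[] r w = ⇒-subC (⇒s-single w) r

Ctx©⊆⇒ : ∀ {n} {M N : Comp n} → Ctx ©R M N → ∃ λ k → M ⇒⟨ k ⟩ N
Ctx©⊆⇒ (root (by-βc (βc-rule M V)))  = _ , pbeta (proj₂ (⇒-refl M)) (⇒v-refl V)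
Ctx©⊆⇒ (root (by-id (id-rule M)))    = _ , pid (proj₂ (⇒-refl M))
Ctx©⊆⇒ (root (by-σ (σ-rule N M L))) = _ , psig (proj₂ (⇒-refl N)) (proj₂ (⇒-refl M)) (proj₂ (⇒-refl L))
Ctx©⊆⇒ (retLam s)   = _ , pret (plam (proj₂ (Ctx©⊆⇒ s)))
Ctx©⊆⇒ (appR V s)   = _ , papp (⇒v-refl V) (proj₂ (Ctx©⊆⇒ s))
Ctx©⊆⇒ (appLam L s) = _ , papp (plam (proj₂ (Ctx©⊆⇒ s))) (proj₂ (⇒-refl L))

data _⇓_ {n} : Comp n → Val n → Set where
  ⇓-ret : ∀ {V} → ret V ⇓ V
  ⇓-app : ∀ {P M W U} → M ⇓ W → P [ W ] ⇓ U → app (lam P) M ⇓ U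

⇓-reflect : ∀ {n} k {M N : Comp n} {U} → M ⇒⟨ k ⟩ N → N ⇓ U → ∃ λ U₀ → M ⇓ U₀ × U₀ ⇒v U
⇓-reflect .0 (pret v) ⇓-ret = _ , ⇓-ret , v
⇓-reflect k (papp (plam q) r) (⇓-app d₁ d₂) =
  let W₀ , e₁ , w = ⇓-reflect k r d₁
      U₀ , e₂ , u = ⇓-reflect _ (⇒-[] q w) d₂
  in  U₀ , ⇓-app e₁ e₂ , u
⇓-reflect (suc k) (pbeta r v) d =
  let U₀ , e , u = ⇓-reflect k (⇒-[] r v) d in U₀ , ⇓-app ⇓-ret e , u
⇓-reflect (suc k) (pid r) d =
  let U₀ , e , u = ⇓-reflect k r d in U₀ , ⇓-app e ⇓-ret , u
⇓-reflect .0 (psig {Q' = Q'} q p l) (⇓-app {W = W} d₁ (⇓-app {W = X} d₂ d₃)) =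
  let W₀ , e₁ , w = ⇓-reflect _ l d₁
      X₀ , e₂ , x = ⇓-reflect _ (⇒-[] p w) d₂
      q[X]        = subst (λ Y → _ ⇒⟨ _ ⟩ Y [ X ]) (sym (weakUnder-[]-cancel Q' W)) (⇒-[] q x)
      U₀ , e₃ , u = ⇓-reflect _ q[X] d₃
  in  U₀ , ⇓-app (⇓-app e₁ e₂) e₃ , u

→©*-ret⇒⇓ : ∀ {n} {M : Comp n} {V} → M →©* ret V → ∃ λ U → M ⇓ U
→©*-ret⇒⇓ ε        = _ , ⇓-ret
→©*-ret⇒⇓ (s ◅ ss) =
  let _ , d      = →©*-ret⇒⇓ ss
      U₀ , e , _ = ⇓-reflect _ (proj₂ (Ctx©⊆⇒ s)) d
  in  U₀ , e

⇓⇒→wβc* : ∀ {n} {M : Comp n} {U} → M ⇓ U → M →wβc* ret U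
⇓⇒→wβc* ⇓-ret = ε
⇓⇒→wβc* (⇓-app {P = P} {W = W} d₁ d₂) =
  gmap (app (lam P)) (appR (lam P)) (⇓⇒→wβc* d₁) ◅◅ root (βc-rule P W) ◅ ⇓⇒→wβc* d₂

WCtxβc⊆Ctx© : ∀ {n} {M N : Comp n} → WCtx βc M N → Ctx ©R M N
WCtxβc⊆Ctx© (root b)   = root (by-βc b)
WCtxβc⊆Ctx© (appR V w) = appR V (WCtxβc⊆Ctx© w)

mainTheorem3 : ∀ {n} (M : Comp n) →
    (∃ λ (V : Val n) → M →©* ret V) ⇔ (∃ λ (U : Val n) → M →wβc* ret U)
mainTheorem3 M = mk⇔ (λ (V , r) → let U , d = →©*-ret⇒⇓ r in U , ⇓⇒→wβc* d)
                     (λ (U , r) → U , map WCtxβc⊆Ctx© r)
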